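{- Let $G_1, G_2$ be abelian groups with $G_2$ free abelian of finite positive rank $r$. Let $\varphi : G_2 \to \mathbb{Z}^r$ be an isomorphism, $A$ a subset of $G_1$ and $u : G_1 \to G_2$ a function. Then none of the subsets $$\bigcup_{a \in A} \{a\} \times \varphi^{ -1}\big(\mathbb{Z}^r_{<\varphi(u(a))}\big), \qquad \bigcup_{a \in A} \{a\} \times \varphi^{ -1}\big(\mathbb{Z}^r_{>\varphi(u(a))}\big)$$ of $G_1 \times G_2$ admits a minimal complement in $G_1 \times G_2$.
   Context: For an abelian group $G$ and nonempty subsets $W, W' \subseteq G$, $W'$ is a complement of $W$ in $G$ if $W + W' = G$; it is a minimal complement if moreover $W + (W' \setminus \{w'\}) \neq G$ for every $w' \in W'$. $\mathbb{Z}^r$ carries the lexicographic (dictionary) order induced by the order of $\mathbb{Z}$; $\mathbb{Z}^r_{<a} = \{z \in \mathbb{Z}^r : z < a\}$ and $\mathbb{Z}^r_{>a} = \{z \in \mathbb{Z}^r : z > a\}$. -}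

module Defs where

open import Level using (Level; _⊔_; 0ℓ)
open import Data.Nat using (ℕ; zero; suc)
open import Data.Integer as ℤ using (ℤ)
open import Data.Vec using (Vec; []; _∷_; zipWith; replicate; map)
open import Data.Product using (Σ; ∃; _×_; _,_; proj₁; proj₂)
open import Data.Sum using (_⊎_)
open import Relation.Nullary using (¬_)
open import Relation.Binary.PropositionalEquality using (_≡_)
open import Algebra.Bundles using (AbelianGroup; RawGroup)
open import Algebra.Morphism.Structures using (module GroupMorphisms)

ℤ^-rawGroup : ℕ → RawGroup 0ℓ 0ℓ
ℤ^-rawGroup r = record
  { Carrier = Vec ℤ r
  ; _≈_ = _≡_
  ; _∙_ = zipWith ℤ._+_
  ; ε = replicate r (ℤ.+ 0)
  ; _⁻¹ = map (λ z → ℤ.- z)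
  }

data _<lex_ : {r : ℕ} → Vec ℤ r → Vec ℤ r → Set where
  here  : ∀ {r x y} {xs ys : Vec ℤ r} → x ℤ.< y → (x ∷ xs) <lex (y ∷ ys)
  there : ∀ {r x y} {xs ys : Vec ℤ r} → x ≡ y → xs <lex ys → (x ∷ xs) <lex (y ∷ ys)

IsIsoToℤ^ : ∀ {c ℓ} (G : AbelianGroup c ℓ) (r : ℕ) → (AbelianGroup.Carrier G → Vec ℤ r) → Set (c ⊔ ℓ)
IsIsoToℤ^ G r φ = GroupMorphisms.IsGroupIsomorphism (AbelianGroup.rawGroup G) (ℤ^-rawGroup r) φ

module _ {c ℓ : Level} (G : AbelianGroup c ℓ) where
  open AbelianGroup G

  Subset : Set (Level.suc (c ⊔ ℓ))
  Subset = Carrier → Set (c ⊔ ℓ)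

  Nonempty : Subset → Set (c ⊔ ℓ)
  Nonempty W = ∃ λ w → W w

  SumsetIsAll : Subset → Subset → Set (c ⊔ ℓ)
  SumsetIsAll W W' = ∀ g → ∃ λ w → ∃ λ w' → W w × W' w' × g ≈ (w ∙ w')

  IsComplement : Subset → Subset → Set (c ⊔ ℓ)
  IsComplement W W' = Nonempty W × Nonempty W' × SumsetIsAll W W'

  Remove : Subset → Carrier → Subset
  Remove W' w' x = W' x × ¬ (x ≈ w')

  IsMinimalComplement : Subset → Subset → Set (c ⊔ ℓ)
  IsMinimalComplement W W' =
    IsComplement W W' × (∀ w' → W' w' → ¬ SumsetIsAll W (Remove W' w'))

  HasMinimalComplement : Subset → Set (Level.suc (c ⊔ ℓ))
  HasMinimalComplement W = ∃ λ (W' : Subset) → IsMinimalComplement W W'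

open import Algebra.Construct.DirectProduct using () renaming (abelianGroup to _×ᴳ_)

module _ {c ℓ : Level} (G₁ G₂ : AbelianGroup c ℓ) {r : ℕ}
         (φ : AbelianGroup.Carrier G₂ → Vec ℤ r)
         (A : Subset G₁)
         (u : AbelianGroup.Carrier G₁ → AbelianGroup.Carrier G₂) where
  open AbelianGroup G₁ renaming (_≈_ to _≈₁_)

  LowerSet : Subset (G₁ ×ᴳ G₂)
  LowerSet (x , y) = ∃ λ a → A a × x ≈₁ a × φ y <lex φ (u a)

  UpperSet : Subset (G₁ ×ᴳ G₂)
  UpperSet (x , y) = ∃ λ a → A a × x ≈₁ a × φ (u a) <lex φ y

module Submission where

-- Let ≺ be a strict total order on G₂ that is invariant
-- under translation (p ≺ q ⇒ p + s ≺ q + s), and let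
--   W = ⋃_{a ∈ A} {a} × {y | y ≺ u(a)}  ⊆  G₁ × G₂.
-- If W' is any complement of W, then EVERY element (b, y) of W' is redundant:
-- to write (x, t) without using (b, y), choose s above both t and
-- c = u(x - b) + y, write (x, s) = (a₀, z₀) + (b', y') with (a₀, z₀) ∈ W, and
-- push the second coordinate down: (x, t) = (a₀, t - y') + (b', y'), where
-- t - y' ⪯ s - y' = z₀ ≺ u(a₀), so (a₀, t - y') ∈ W.  And (b', y') ≠ (b, y),
-- since otherwise s = z₀ + y ≺ u(x - b) + y = c ⪯ s.  Hence W has no minimal
-- complement.
--
-- The theorem follows by
-- applying it to the pullback of the lexicographic order along φ (lower sets)
-- and to its reverse (upper sets).

open import Defs
open import Level using (Level; _⊔_; 0ℓ)
open import Data.Nat using (ℕ; NonZero)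
open import Data.Integer using (ℤ)
import Data.Integer as ℤ
import Data.Integer.Properties as ℤ
open import Data.Vec using (Vec; []; _∷_; zipWith)
open import Data.Product using (_×_; _,_; ∃)
open import Data.Sum using (inj₁; inj₂)
open import Function using (flip; _on_)
open import Relation.Nullary using (¬_)
open import Relation.Binary using (Rel; IsStrictTotalOrder; Trichotomous; Tri; tri<; tri≈; tri>)
open import Relation.Binary.PropositionalEquality using (_≡_; refl; sym; resp₂; isEquivalence)
import Relation.Binary.Construct.Flip.EqAndOrd as Flip
import Relation.Binary.Construct.StrictToNonStrict as StrictToNonStrict
open import Algebra.Bundles using (Group; AbelianGroup; RawGroup)
open import Algebra.Construct.DirectProduct using () renaming (abelianGroup to _×ᴳ_)
open import Algebra.Morphism.Structures using (module GroupMorphisms)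
import Algebra.Properties.AbelianGroup as AbelianGroupProperties

-- A translation-invariant strict total order on a group: the structure that
-- the argument actually needs from ℤ^r with its lexicographic order.
record IsInvariantOrder {c ℓ o} (G : RawGroup c ℓ)
                        (_≺_ : Rel (RawGroup.Carrier G) o) : Set (c ⊔ ℓ ⊔ o) where
  open RawGroup G
  field
    isStrictTotalOrder : IsStrictTotalOrder _≈_ _≺_
    ∙-monoˡ            : ∀ {p q} s → p ≺ q → (p ∙ s) ≺ (q ∙ s)

  open IsStrictTotalOrder isStrictTotalOrder public

flip-invariant : ∀ {c ℓ o} {G : RawGroup c ℓ} {_≺_ : Rel (RawGroup.Carrier G) o} →
                 IsInvariantOrder G _≺_ → IsInvariantOrder G (flip _≺_)
flip-invariant inv = record
  { isStrictTotalOrder = Flip.isStrictTotalOrder isStrictTotalOrder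
  ; ∙-monoˡ            = ∙-monoˡ
  } where open IsInvariantOrder inv

module _ {c ℓ c' ℓ' o} (G : Group c ℓ) {H : RawGroup c' ℓ'}
         {φ : Group.Carrier G → RawGroup.Carrier H}
         (φ-mono : GroupMorphisms.IsGroupMonomorphism (Group.rawGroup G) H φ)
         {_≺_ : Rel (RawGroup.Carrier H) o}
         (inv : IsInvariantOrder H _≺_) where
  private
    module G = Group G
    module I = IsInvariantOrder inv
  open GroupMorphisms.IsGroupMonomorphism φ-mono

  compare-on : Trichotomous G._≈_ (_≺_ on φ)
  compare-on p q with I.compare (φ p) (φ q)
  ... | tri< lt ¬eq ¬gt = tri< lt (λ eq → ¬eq (⟦⟧-cong eq)) ¬gt
  ... | tri≈ ¬lt eq ¬gt = tri≈ ¬lt (injective eq) ¬gt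
  ... | tri> ¬lt ¬eq gt = tri> ¬lt (λ eq → ¬eq (⟦⟧-cong eq)) gt

  pullback-invariant : IsInvariantOrder G.rawGroup (_≺_ on φ)
  pullback-invariant = record
    { isStrictTotalOrder = record
      { isStrictPartialOrder = record
        { isEquivalence = G.isEquivalence
        ; irrefl        = λ eq → I.irrefl (⟦⟧-cong eq)
        ; trans         = I.trans
        ; <-resp-≈      = (λ eq → I.<-respʳ-≈ (⟦⟧-cong eq))
                        , (λ eq → I.<-respˡ-≈ (⟦⟧-cong eq))
        }
      ; compare = compare-on
      }
    ; ∙-monoˡ = λ {p} {q} s lt →
        I.<-respʳ-≈ (I.Eq.sym (∙-homo q s))
          (I.<-respˡ-≈ (I.Eq.sym (∙-homo p s)) (I.∙-monoˡ (φ s) lt))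
    }

<lex-trans : ∀ {r} {xs ys zs : Vec ℤ r} → xs <lex ys → ys <lex zs → xs <lex zs
<lex-trans (here p)       (here q)       = here (ℤ.<-trans p q)
<lex-trans (here p)       (there refl q) = here p
<lex-trans (there refl p) (here q)       = here q
<lex-trans (there refl p) (there refl q) = there refl (<lex-trans p q)

<lex-irrefl : ∀ {r} {xs ys : Vec ℤ r} → xs ≡ ys → ¬ (xs <lex ys)
<lex-irrefl refl (here p)    = ℤ.<-irrefl refl p
<lex-irrefl refl (there _ p) = <lex-irrefl refl p

<lex-+ : ∀ {r} {xs ys : Vec ℤ r} (zs : Vec ℤ r) → xs <lex ys →
         zipWith ℤ._+_ xs zs <lex zipWith ℤ._+_ ys zs
<lex-+ (z ∷ zs) (here p)       = here (ℤ.+-monoˡ-< z p)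
<lex-+ (z ∷ zs) (there refl p) = there refl (<lex-+ zs p)

<lex-tri< : ∀ {r} {xs ys : Vec ℤ r} → xs <lex ys → Tri (xs <lex ys) (xs ≡ ys) (ys <lex xs)
<lex-tri< lt = tri< lt (λ eq → <lex-irrefl eq lt) (λ gt → <lex-irrefl refl (<lex-trans lt gt))

<lex-tri> : ∀ {r} {xs ys : Vec ℤ r} → ys <lex xs → Tri (xs <lex ys) (xs ≡ ys) (ys <lex xs)
<lex-tri> gt = tri> (λ lt → <lex-irrefl refl (<lex-trans lt gt)) (λ eq → <lex-irrefl (sym eq) gt) gt

<lex-compare : ∀ {r} → Trichotomous _≡_ (_<lex_ {r})
<lex-compare [] [] = tri≈ (λ ()) refl (λ ())
<lex-compare (x ∷ xs) (y ∷ ys) with ℤ.<-cmp x y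
... | tri< x<y _ _ = <lex-tri< (here x<y)
... | tri> _ _ y<x = <lex-tri> (here y<x)
... | tri≈ _ refl _ with <lex-compare xs ys
...   | tri< lt _ _   = <lex-tri< (there refl lt)
...   | tri≈ _ refl _ = tri≈ (<lex-irrefl refl) refl (<lex-irrefl refl)
...   | tri> _ _ gt   = <lex-tri> (there refl gt)

<lex-invariant : ∀ {r} → IsInvariantOrder (ℤ^-rawGroup r) _<lex_
<lex-invariant = record
  { isStrictTotalOrder = record
    { isStrictPartialOrder = record
      { isEquivalence = isEquivalence
      ; irrefl        = <lex-irrefl
      ; trans         = <lex-trans
      ; <-resp-≈      = resp₂ _<lex_
      }
    ; compare = <lex-compare
    }
  ; ∙-monoˡ = <lex-+
  }

module NoMinimalComplement {c ℓ : Level} (G₁ G₂ : AbelianGroup c ℓ)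
  {_≺_ : Rel (AbelianGroup.Carrier G₂) 0ℓ}
  (≺-invariant : IsInvariantOrder (AbelianGroup.rawGroup G₂) _≺_)
  (A : Subset G₁) (u : AbelianGroup.Carrier G₁ → AbelianGroup.Carrier G₂)
  (u-cong : ∀ {x y} → AbelianGroup._≈_ G₁ x y → AbelianGroup._≈_ G₂ (u x) (u y))
  where
  private
    module G₁ = AbelianGroup G₁
    module G₂ = AbelianGroup G₂
    module G = AbelianGroup (G₁ ×ᴳ G₂)
    module P₁ = AbelianGroupProperties G₁
    module P₂ = AbelianGroupProperties G₂
    module I = IsInvariantOrder ≺-invariant
    module ⪯ = StrictToNonStrict G₂._≈_ _≺_
  open G₁ using () renaming (_≈_ to _≈₁_; _-_ to _-₁_)
  open G₂ using () renaming (_≈_ to _≈₂_; _∙_ to _+₂_; _-_ to _-₂_)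
  open ⪯ using () renaming (_≤_ to _⪯_)

  Below : Subset (G₁ ×ᴳ G₂)
  Below (x , y) = ∃ λ a → A a × x ≈₁ a × y ≺ u a

  Below-downward : ∀ {x z z'} → Below (x , z) → z' ⪯ z → Below (x , z')
  Below-downward (a , a∈A , x≈a , z≺ua) z'⪯z =
    a , a∈A , x≈a , ⪯.≤-<-trans G₂.sym I.trans I.<-respˡ-≈ z'⪯z z≺ua

  ⪯-monoˡ : ∀ {p q} s → p ⪯ q → (p +₂ s) ⪯ (q +₂ s)
  ⪯-monoˡ s (inj₁ p≺q) = inj₁ (I.∙-monoˡ s p≺q)
  ⪯-monoˡ s (inj₂ p≈q) = inj₂ (G₂.∙-congʳ p≈q)

  upper-bound : ∀ p q → ∃ λ s → p ⪯ s × q ⪯ s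
  upper-bound p q with ⪯.total I.compare p q
  ... | inj₁ p⪯q = q , p⪯q , inj₂ G₂.refl
  ... | inj₂ q⪯p = p , inj₂ G₂.refl , q⪯p

  sum-bound : ∀ {x s b y} w → Below w → G._≈_ (x , s) (w G.∙ (b , y)) →
              s ≺ (u (x -₁ b) +₂ y)
  sum-bound {x} {s} {b} {y} (a₀ , z₀) (a , _ , a₀≈a , z₀≺ua) (x≈a₀+b , s≈z₀+y) =
    I.<-respʳ-≈ (G₂.∙-congʳ (u-cong (G₁.sym x-b≈a)))
      (I.<-respˡ-≈ (G₂.sym s≈z₀+y) (I.∙-monoˡ y z₀≺ua))
    where
    x-b≈a : (x -₁ b) ≈₁ a
    x-b≈a = G₁.trans (G₁.∙-congʳ x≈a₀+b) (G₁.trans (P₁.//-rightDividesʳ b a₀) a₀≈a)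

  shift-down : ∀ {x s t} w w' → Below w → G._≈_ (x , s) (w G.∙ w') → t ⪯ s →
               ∃ λ w'' → Below w'' × G._≈_ (x , t) (w'' G.∙ w')
  shift-down {s = s} {t} (a₀ , z₀) (b' , y') w∈Below (x≈a₀+b' , s≈z₀+y') t⪯s =
    (a₀ , t -₂ y') , Below-downward w∈Below t-y'⪯z₀ ,
    (x≈a₀+b' , G₂.sym (P₂.//-rightDividesˡ y' t))
    where
    s-y'≈z₀ : (s -₂ y') ≈₂ z₀
    s-y'≈z₀ = G₂.trans (G₂.∙-congʳ s≈z₀+y') (P₂.//-rightDividesʳ y' z₀)
    t-y'⪯z₀ : (t -₂ y') ⪯ z₀
    t-y'⪯z₀ = ⪯.≤-respʳ-≈ G₂.trans I.<-respʳ-≈ s-y'≈z₀ (⪯-monoˡ (y' G₂.⁻¹) t⪯s)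

  redundant : ∀ {W'} → SumsetIsAll (G₁ ×ᴳ G₂) Below W' →
              ∀ w → SumsetIsAll (G₁ ×ᴳ G₂) Below (Remove (G₁ ×ᴳ G₂) W' w)
  redundant cover (b , y) (x , t) with upper-bound t (u (x -₁ b) +₂ y)
  ... | s , t⪯s , c⪯s with cover (x , s)
  ... | w , w' , w∈Below , w'∈W' , x,s≈w+w' with shift-down w w' w∈Below x,s≈w+w' t⪯s
  ... | w'' , w''∈Below , x,t≈w''+w' =
    w'' , w' , w''∈Below , (w'∈W' , w'≉b,y) , x,t≈w''+w'
    where
    w'≉b,y : ¬ G._≈_ w' (b , y)
    w'≉b,y w'≈b,y = I.irrefl G₂.refl (⪯.<-≤-trans I.trans I.<-respʳ-≈ s≺c c⪯s)
      where
      s≺c : s ≺ (u (x -₁ b) +₂ y)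
      s≺c = sum-bound w w∈Below (G.trans x,s≈w+w' (G.∙-congˡ w'≈b,y))

  -- A minimal complement is nonempty, yet none of its elements is needed.
  no-minimal-complement : ¬ HasMinimalComplement (G₁ ×ᴳ G₂) Below
  no-minimal-complement (W' , (_ , (w' , w'∈W') , cover) , minimal) =
    minimal w' w'∈W' (redundant cover w')

proposition3p4 : ∀ {c ℓ : Level} (G₁ G₂ : AbelianGroup c ℓ) (r : ℕ) → .{{NonZero r}} →
    (φ : AbelianGroup.Carrier G₂ → Vec ℤ r) → IsIsoToℤ^ G₂ r φ →
    (A : Subset G₁) (u : AbelianGroup.Carrier G₁ → AbelianGroup.Carrier G₂) →
    (∀ {x y} → AbelianGroup._≈_ G₁ x y → AbelianGroup._≈_ G₂ (u x) (u y)) →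
    ¬ HasMinimalComplement (G₁ ×ᴳ G₂) (LowerSet G₁ G₂ φ A u)
      × ¬ HasMinimalComplement (G₁ ×ᴳ G₂) (UpperSet G₁ G₂ φ A u)
proposition3p4 G₁ G₂ r φ φ-iso A u u-cong =
    NoMinimalComplement.no-minimal-complement G₁ G₂ lex-on-φ A u u-cong
  , NoMinimalComplement.no-minimal-complement G₁ G₂ (flip-invariant lex-on-φ) A u u-cong
  where
  -- p ≺ q iff φ p <lex φ q ; LowerSet is Below for this order, UpperSet for its reverse.
  lex-on-φ : IsInvariantOrder (AbelianGroup.rawGroup G₂) (_<lex_ on φ)
  lex-on-φ = pullback-invariant (AbelianGroup.group G₂)
    (GroupMorphisms.IsGroupIsomorphism.isGroupMonomorphism φ-iso) <lex-invariant
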